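{- There exists a deterministic algorithm that, given a dynamic matroid $\mathcal M$ on at most $n$ elements with weight function $w\colon E \to \{1, \dots, W\}$ (the weight of an element being specified when it is inserted), maintains a minimum weight base of the current matroid, where each update (element insertion or deletion) uses $O(\log(Wn))$ rank-queries.
   Context: A matroid $\mathcal M=(E,\mathcal I)$ consists of a finite ground set $E$ and a family $\mathcal I$ of independent sets satisfying $\emptyset\in\mathcal I$, downward closure, and the exchange property. The rank of $A\subseteq E$ is $\mathrm{rk}(A)=\max\{|A'|: A'\in\mathcal I, A'\subseteq A\}$; a base is a maximal independent set. A minimum weight base is a base $B$ minimizing $w(B)=\sum_{e\in B}w(e)$. The algorithm accesses the matroid only through a rank oracle, which on query $A\subseteq E$ (for the current ground set) returns $\mathrm{rk}(A)$. A dynamic matroid undergoes updates: deleting an element $e$ restricts $\mathcal M$ to $E\setminus\{e\}$ (independent sets become those not containing $e$); inserting an element $e$ replaces $\mathcal M$ by a matroid on $E\cup\{e\}$ with independent sets $\mathcal I\cup\mathcal I_e$, where every set in $\mathcal I_e$ contains $e$ (chosen by the adversary). After each update the algorithm may query the rank oracle of the new matroid. $n$ denotes an upper bound on the number of elements present at any time. -}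

module Defs where

open import Data.Nat using (ℕ; zero; suc; _+_; _*_; _≤_; _<_; _≡ᵇ_)
open import Data.Nat.Properties using ()
open import Data.Bool using (if_then_else_)
open import Data.List using (List; []; _∷_; length; map)
open import Data.Nat.ListAction using (sum)
open import Data.List.Membership.Propositional using (_∈_; _∉_)
open import Data.List.Relation.Binary.Subset.Propositional using (_⊆_)
open import Data.List.Relation.Unary.Unique.Propositional using (Unique)
open import Data.List.Relation.Unary.AllPairs using ([])
open import Data.Product using (Σ; _×_; _,_; ∃-syntax)
open import Data.Sum using (_⊎_)
open import Data.Empty using (⊥)
open import Relation.Nullary using (¬_; yes; no)
open import Relation.Unary using (Decidable)
open import Relation.Binary.PropositionalEquality using (_≡_; _≢_; refl)
open import Function.Bundles using (_⇔_)

-- Matroids on a finite ground set of element labels (natural numbers).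
-- Sets are represented by lists; independent sets are duplicate-free.

record Matroid : Set₁ where
  field
    ground        : List ℕ
    ground-unique : Unique ground
    Indep         : List ℕ → Set
    indep?        : Decidable Indep
    indep-unique  : ∀ {A} → Indep A → Unique A
    indep-ground  : ∀ {A} → Indep A → A ⊆ ground
    indep-[]      : Indep []
    -- downward closure (also gives invariance under reordering)
    indep-down    : ∀ {A B} → Unique B → B ⊆ A → Indep A → Indep B
    indep-exch    : ∀ {A B} → Indep A → Indep B → length A < length B →
                    ∃[ x ] (x ∈ B × x ∉ A × Indep (x ∷ A))

open Matroid public

IsRank : Matroid → List ℕ → ℕ → Set
IsRank M A r =
  (∃[ A' ] (A' ⊆ A × Indep M A' × length A' ≡ r)) ×
  (∀ A' → A' ⊆ A → Indep M A' → length A' ≤ r)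

IsBase : Matroid → List ℕ → Set
IsBase M B = Indep M B × (∀ B' → Indep M B' → B ⊆ B' → B' ⊆ B)

Weighting : Set
Weighting = ℕ → ℕ

weight : Weighting → List ℕ → ℕ
weight w B = sum (map w B)

IsMinBase : Matroid → Weighting → List ℕ → Set
IsMinBase M w B = IsBase M B × (∀ B' → IsBase M B' → weight w B ≤ weight w B')

setWeight : Weighting → ℕ → ℕ → Weighting
setWeight w e x y = if y ≡ᵇ e then x else w y

emptyMatroid : Matroid
emptyMatroid = record
  { ground = []
  ; ground-unique = []
  ; Indep = λ A → A ≡ []
  ; indep? = dec
  ; indep-unique = λ { refl → [] }
  ; indep-ground = λ { refl () }
  ; indep-[] = refl
  ; indep-down = down
  ; indep-exch = λ { refl refl () }
  }
  where
  dec : Decidable (λ (A : List ℕ) → A ≡ [])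
  dec [] = yes refl
  dec (_ ∷ _) = no (λ ())
  down : ∀ {A B : List ℕ} → Unique B → B ⊆ A → A ≡ [] → B ≡ []
  down {B = []} _ _ _ = refl
  down {B = x ∷ B} _ sub refl with sub (Data.List.Relation.Unary.Any.here refl)
    where import Data.List.Relation.Unary.Any
  ... | ()

data Update : Set where
  del : (e : ℕ) → Update
  ins : (e : ℕ) (x : ℕ) → Update

IsDeletion : Matroid → ℕ → Matroid → Set
IsDeletion M e M' =
  (∀ x → (x ∈ ground M') ⇔ (x ∈ ground M × x ≢ e)) ×
  (∀ A → Indep M' A ⇔ (Indep M A × e ∉ A))

-- insertion of e: ground set E ∪ {e}, independent sets I ∪ I_e where
-- every set of I_e contains e (I_e chosen arbitrarily by the adversary)
IsInsertion : Matroid → ℕ → Matroid → Set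
IsInsertion M e M' =
  (∀ x → (x ∈ ground M') ⇔ (x ≡ e ⊎ x ∈ ground M)) ×
  (∀ A → e ∉ A → (Indep M' A ⇔ Indep M A))

data ValidUpdate (n W : ℕ) :
       Matroid → Weighting → Update → Matroid → Weighting → Set₁ where
  vdel : ∀ {M M' w e} → e ∈ ground M → IsDeletion M e M' →
         length (ground M') ≤ n →
         ValidUpdate n W M w (del e) M' w
  vins : ∀ {M M' w e x} → e ∉ ground M → 1 ≤ x → x ≤ W →
         IsInsertion M e M' → length (ground M') ≤ n →
         ValidUpdate n W M w (ins e x) M' (setWeight w e x)

-- an adaptive query procedure: ask rank queries, then return a new
-- internal state and an output set (the claimed base)
data Proc (S : Set) : Set where
  done : S → List ℕ → Proc S
  ask  : List ℕ → (ℕ → Proc S) → Proc S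

record Algorithm : Set₁ where
  field
    State : Set
    init  : State
    step  : State → Update → Proc State

open Algorithm public

data Runs (M : Matroid) {S : Set} : Proc S → S → List ℕ → ℕ → Set where
  run-done : ∀ {s B} → Runs M (done s B) s B 0
  run-ask  : ∀ {A k r s B q} → IsRank M A r → Runs M (k r) s B q →
             Runs M (ask A k) s B (suc q)

data Reachable (n W : ℕ) (alg : Algorithm) :
       Matroid → Weighting → State alg → Set₁ where
  reach-init : Reachable n W alg emptyMatroid (λ _ → 0) (init alg)
  reach-step : ∀ {M w s u M' w' s' B q} →
               Reachable n W alg M w s →
               ValidUpdate n W M w u M' w' →
               Runs M' (step alg s u) s' B q →
               Reachable n W alg M' w' s'

-- The state is a table of the current elements sorted by decreasing weight, each entry marked
-- as in or out of the base, with the invariant that an entry is marked exactly when it raises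
-- the rank of the lighter entries.  The marked entries are then the choices of the greedy
-- algorithm, hence a minimum-weight base, and the rank of every suffix of the table is its
-- number of marks, so one rank query decides whether an element augments a suffix.
--
-- Inserting e between the heavier part Hi and the lighter part Lo marks e iff e augments Lo.
-- If it does, exactly one entry u of Hi loses its mark: the lightest one such that u and the
-- entries between u and e span e.  Every other entry x keeps its mark, because adding x to the
-- entries below it does not change whether e augments them (augments-swap).  As "e augments
-- the suffix" can only fail further up Hi, u is the cut found by a binary search over Hi with
-- ⌊log₂ n⌋ + 1 queries.  Deleting a marked e symmetrically marks the entry u that replaces it.

module Submission where

open import Defs
open import Data.Bool using (Bool; true; false; T; if_then_else_)
open import Data.Bool.Properties using (T?)
open import Data.Empty using (⊥-elim)
open import Data.List using (List; []; _∷_; _++_; length; map; filter; filterᵇ; span; break)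
open import Data.List.Membership.Propositional using (_∈_; _∉_)
open import Data.List.Membership.Propositional.Properties
  using (∈-∃++; ∈-map⁻; ∈-map⁺; ∈-filter⁺; ∈-filter⁻)
open import Data.List.Properties using (++-assoc; map-++; map-∘; length-++; length-map)
open import Data.List.Relation.Binary.Permutation.Propositional
  using (_↭_; prep; swap; ↭-refl; ↭-sym; ↭-trans; ↭⇒↭ₛ; module PermutationReasoning)
open import Data.List.Relation.Binary.Permutation.Propositional.Properties
  using (shift; All-resp-↭; ∈-resp-↭) renaming (map⁺ to map⁺-↭; ++⁺ˡ to ++⁺ˡ-↭)
open import Data.List.Relation.Binary.Subset.Propositional using (_⊆_)
open import Data.List.Relation.Binary.Subset.Propositional.Properties
  using (∈-∷⁺ʳ; ⊆-trans; ⊆-reflexive; ⊆-reflexive-↭; ⊆-respʳ-↭; ⊆∷∧∉⇒⊆; ++⁺ˡ;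
         xs⊆ys++xs; filter-⊆)
  renaming (map⁺ to map⁺-⊆)
open import Data.List.Relation.Unary.All using (All; []; _∷_)
import Data.List.Relation.Unary.All as All
import Data.List.Relation.Unary.All.Properties as All
open import Data.List.Relation.Unary.AllPairs using (AllPairs; []; _∷_)
import Data.List.Relation.Unary.AllPairs.Properties as AllPairs
open import Data.List.Relation.Unary.Any using (here; there)
open import Data.List.Relation.Unary.Unique.Propositional using (Unique)
open import Data.List.Relation.Unary.Unique.Propositional.Properties using (Unique[x∷xs]⇒x∉xs)
open import Data.Nat
  using (ℕ; zero; suc; _+_; _*_; _^_; _∸_; _≤_; _<_; _≤?_; _<?_; _≟_; _≡ᵇ_; _<ᵇ_; z≤n; s≤s;
         ⌊_/2⌋; ⌈_/2⌉)
open import Data.Nat.ListAction using (sum)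
open import Data.Nat.ListAction.Properties using (sum-↭)
open import Data.Nat.Logarithm using (⌊log₂_⌋; ⌊log₂⌋-mono-≤; ⌊log₂[2^n]⌋≡n)
open import Data.Nat.Properties
open import Algebra.Properties.CommutativeSemigroup +-commutativeSemigroup
  using (interchange; x∙yz≈y∙xz)
open import Data.List.Membership.DecPropositional _≟_ using (_∈?_)
open import Data.Product using (Σ; Σ-syntax; ∃-syntax; _×_; _,_; proj₁; proj₂; uncurry)
open import Data.Sum using (_⊎_; inj₁; inj₂)
open import Function using (_∘_; _on_; id)
open import Function.Bundles using (_⇔_; mk⇔; Equivalence)
open import Function.Construct.Composition using (_⇔-∘_)
open import Function.Construct.Symmetry using (⇔-sym)
open import Level using (0ℓ)
open import Relation.Nullary using (¬_; yes; no; contradiction)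
open import Relation.Unary using (Pred; Decidable)
open import Relation.Binary.PropositionalEquality
  using (_≡_; _≢_; refl; sym; trans; cong; cong₂; subst; subst₂; setoid; module ≡-Reasoning)
open import Data.List.Relation.Binary.Permutation.Setoid.Properties (setoid ℕ) using (Unique-resp-↭)

∉⇒Unique-∷ : ∀ {x : ℕ} {xs} → x ∉ xs → Unique xs → Unique (x ∷ xs)
∉⇒Unique-∷ x∉xs u = All.¬Any⇒All¬ _ x∉xs ∷ u

weight-mono : ∀ w {xs ys : List ℕ} → Unique xs → xs ⊆ ys → weight w xs ≤ weight w ys
weight-mono w {[]}     _               _     = z≤n
weight-mono w {x ∷ xs} !x∷xs@(_ ∷ !xs) xs⊆ys with ∈-∃++ (xs⊆ys (here refl))
... | ys₁ , ys₂ , refl = begin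
  w x + weight w xs          ≤⟨ +-monoʳ-≤ (w x) (weight-mono w !xs xs⊆ys₁++ys₂) ⟩
  w x + weight w (ys₁ ++ ys₂) ≡⟨ sum-↭ (map⁺-↭ w (↭-sym (shift x ys₁ ys₂))) ⟩
  weight w (ys₁ ++ x ∷ ys₂)   ∎
  where
  open ≤-Reasoning
  xs⊆ys₁++ys₂ : xs ⊆ ys₁ ++ ys₂
  xs⊆ys₁++ys₂ = ⊆∷∧∉⇒⊆ (⊆-respʳ-↭ (shift x ys₁ ys₂) (xs⊆ys ∘ there))
                        (Unique[x∷xs]⇒x∉xs !x∷xs)

length-mono : ∀ {xs ys : List ℕ} → Unique xs → xs ⊆ ys → length xs ≤ length ys
length-mono {xs} {ys} !xs xs⊆ys =
  subst₂ _≤_ (weight-const-1 xs) (weight-const-1 ys) (weight-mono (λ _ → 1) !xs xs⊆ys)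
  where
  weight-const-1 : ∀ zs → weight (λ _ → 1) zs ≡ length zs
  weight-const-1 []       = refl
  weight-const-1 (_ ∷ zs) = cong suc (weight-const-1 zs)

-- Rank

basisOf : Matroid → List ℕ → List ℕ
basisOf M []      = []
basisOf M (x ∷ A) with indep? M (x ∷ basisOf M A)
... | yes _ = x ∷ basisOf M A
... | no  _ = basisOf M A

module _ (M : Matroid) where

  basisOf-indep : ∀ A → Indep M (basisOf M A)
  basisOf-indep []      = indep-[] M
  basisOf-indep (x ∷ A) with indep? M (x ∷ basisOf M A)
  ... | yes i = i
  ... | no  _ = basisOf-indep A

  basisOf-⊆ : ∀ A → basisOf M A ⊆ A
  basisOf-⊆ (x ∷ A) with indep? M (x ∷ basisOf M A)
  ... | yes _ = ∈-∷⁺ʳ (here refl) (there ∘ basisOf-⊆ A)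
  ... | no  _ = there ∘ basisOf-⊆ A

  basisOf-maximal : ∀ A {y} → y ∈ A → ¬ Indep M (y ∷ basisOf M A)
  basisOf-maximal (x ∷ A) y∈x∷A with indep? M (x ∷ basisOf M A) | y∈x∷A
  ... | no ¬i | here refl = ¬i
  ... | no _  | there y∈A = basisOf-maximal A y∈A
  ... | yes _ | here refl = λ i → Unique[x∷xs]⇒x∉xs (indep-unique M i) (here refl)
  ... | yes _ | there y∈A = λ i → basisOf-maximal A y∈A
    (indep-down M (drop-second (indep-unique M i)) (∈-∷⁺ʳ (here refl) (there ∘ there)) i)
    where
    drop-second : ∀ {y x : ℕ} {G} → Unique (y ∷ x ∷ G) → Unique (y ∷ G)
    drop-second ((_ ∷ y∉G) ∷ (_ ∷ !G)) = y∉G ∷ !G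

-- Opaque, so that unification compares ranks instead of unfolding basisOf.
opaque
  rk : Matroid → List ℕ → ℕ
  rk M A = length (basisOf M A)

Augments : Matroid → ℕ → List ℕ → Set
Augments M x A = rk M (x ∷ A) ≡ suc (rk M A)

record IsBasisOf (M : Matroid) (A J : List ℕ) : Set where
  field
    independent : Indep M J
    subset      : J ⊆ A
    maximum     : length J ≡ rk M A

module _ {M : Matroid} where

  opaque
    unfolding rk

    rk-max : ∀ {A J} → Indep M J → J ⊆ A → length J ≤ rk M A
    rk-max {A} {J} iJ J⊆A with length J ≤? rk M A
    ... | yes ≤rk = ≤rk
    ... | no  ≰rk with indep-exch M (basisOf-indep M A) iJ (≰⇒> ≰rk)
    ... | y , y∈J , _ , i = contradiction i (basisOf-maximal M A (J⊆A y∈J))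

    rk-[] : rk M [] ≡ 0
    rk-[] = refl

    basisOf-isBasis : ∀ A → IsBasisOf M A (basisOf M A)
    basisOf-isBasis A = record { independent = basisOf-indep M A ; subset = basisOf-⊆ M A ; maximum = refl }

    rk-∷ : ∀ x A → rk M (x ∷ A) ≡ rk M A ⊎ Augments M x A
    rk-∷ x A with indep? M (x ∷ basisOf M A)
    ... | yes _ = inj₂ refl
    ... | no  _ = inj₁ refl

  rk-isRank : ∀ A → IsRank M A (rk M A)
  rk-isRank A = (basisOf M A , subset , independent , maximum) , λ _ A'⊆A iA' → rk-max iA' A'⊆A
    where open IsBasisOf (basisOf-isBasis A)

  rk-unique : ∀ {A r} → IsRank M A r → rk M A ≡ r
  rk-unique {A} ((A' , A'⊆A , iA' , refl) , max) =
    ≤-antisym (≤-trans (≤-reflexive (sym maximum)) (max _ subset independent)) (rk-max iA' A'⊆A)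
    where open IsBasisOf (basisOf-isBasis A)

  rk-mono : ∀ {A B} → A ⊆ B → rk M A ≤ rk M B
  rk-mono {A} A⊆B = ≤-trans (≤-reflexive (sym maximum)) (rk-max independent (A⊆B ∘ subset))
    where open IsBasisOf (basisOf-isBasis A)

  rk-resp-↭ : ∀ {A B} → A ↭ B → rk M A ≡ rk M B
  rk-resp-↭ A↭B =
    ≤-antisym (rk-mono (⊆-reflexive-↭ A↭B)) (rk-mono (⊆-reflexive-↭ (↭-sym A↭B)))

  ¬augments⇒rk-∷ : ∀ {x A} → ¬ Augments M x A → rk M (x ∷ A) ≡ rk M A
  ¬augments⇒rk-∷ {x} {A} ¬aug with rk-∷ x A
  ... | inj₁ eq  = eq
  ... | inj₂ aug = contradiction aug ¬aug

  rk-∷-≤ : ∀ x A → rk M (x ∷ A) ≤ suc (rk M A)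
  rk-∷-≤ x A with rk-∷ x A
  ... | inj₁ eq  = ≤-trans (≤-reflexive eq) (n≤1+n _)
  ... | inj₂ aug = ≤-reflexive aug

  augments-resp-↭ : ∀ {x A B} → A ↭ B → Augments M x A → Augments M x B
  augments-resp-↭ {x} A↭B aug =
    trans (rk-resp-↭ (prep x (↭-sym A↭B))) (trans aug (cong suc (rk-resp-↭ A↭B)))

  basis-∷ : ∀ {x A J} → IsBasisOf M A J → Augments M x A → Indep M (x ∷ J)
  basis-∷ {x} {A} {J} basis aug with indep-exch M J.independent K.independent |J|<|K|
    where
    module J = IsBasisOf basis
    module K = IsBasisOf (basisOf-isBasis (x ∷ A))
    |J|<|K| : length J < length (basisOf M (x ∷ A))
    |J|<|K| = ≤-trans (s≤s (≤-reflexive J.maximum)) (≤-reflexive (trans (sym aug) (sym K.maximum)))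
  ... | y , y∈K , _ , iy∷J with basisOf-⊆ M (x ∷ A) y∈K
  ...   | here refl = iy∷J
  ...   | there y∈A = contradiction (rk-max iy∷J (∈-∷⁺ʳ y∈A subset)) (<-irrefl maximum)
    where open IsBasisOf basis

  basis-extend : ∀ {I B} → Indep M I → I ⊆ B → ∃[ J ] (I ⊆ J × IsBasisOf M B J)
  basis-extend {I} {B} iI I⊆B = go (rk M B ∸ length I) (m∸n+n≡m (rk-max iI I⊆B)) iI I⊆B
    where
    go : ∀ k {I} → k + length I ≡ rk M B → Indep M I → I ⊆ B →
         ∃[ J ] (I ⊆ J × IsBasisOf M B J)
    go zero    {I} |I|≡rk iI I⊆B =
      I , id , record { independent = iI ; subset = I⊆B ; maximum = |I|≡rk }
    go (suc k) {I} k+|I|≡rk iI I⊆B with indep-exch M iI G.independent |I|<|G|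
      where
      module G = IsBasisOf (basisOf-isBasis B)
      |I|<|G| : length I < length (basisOf M B)
      |I|<|G| = ≤-trans (s≤s (m≤n+m _ k)) (≤-reflexive (trans k+|I|≡rk (sym G.maximum)))
    ... | y , y∈G , _ , iy∷I
      with go k (trans (+-suc k _) k+|I|≡rk) iy∷I (∈-∷⁺ʳ (basisOf-⊆ M B y∈G) I⊆B)
    ... | J , y∷I⊆J , basis = J , y∷I⊆J ∘ there , basis

  augments-antitone : ∀ {x A B} → A ⊆ B → Augments M x B → Augments M x A
  augments-antitone {x} {A} {B} A⊆B aug with basis-extend G.independent (A⊆B ∘ G.subset)
    where module G = IsBasisOf (basisOf-isBasis A)
  ... | J , G⊆J , basis = ≤-antisym (rk-∷-≤ x A) (begin
    suc (rk M A)                ≡⟨ cong suc (sym G.maximum) ⟩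
    length (x ∷ basisOf M A)     ≤⟨ rk-max ix∷G (∈-∷⁺ʳ (here refl) (there ∘ G.subset)) ⟩
    rk M (x ∷ A)                ∎)
    where
    open ≤-Reasoning
    module G = IsBasisOf (basisOf-isBasis A)
    ix∷J : Indep M (x ∷ J)
    ix∷J = basis-∷ basis aug
    ix∷G : Indep M (x ∷ basisOf M A)
    ix∷G = indep-down M
      (∉⇒Unique-∷ (Unique[x∷xs]⇒x∉xs (indep-unique M ix∷J) ∘ G⊆J)
                  (indep-unique M G.independent))
      (∈-∷⁺ʳ (here refl) (there ∘ G⊆J)) ix∷J

  augments-shift : ∀ δ {x e A} → rk M (x ∷ e ∷ A) ≡ δ + rk M (x ∷ A) →
                   rk M (e ∷ A) ≡ δ + rk M A → Augments M x (e ∷ A) ⇔ Augments M x A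
  augments-shift δ p q rewrite p | q = mk⇔ (λ h → +-cancelˡ-≡ δ _ _ (trans h (sym (+-suc δ _))))
                                           (λ h → trans (cong (δ +_) h) (+-suc δ _))

  -- Both rank increments are read off rk (x ∷ e ∷ A) ≡ rk (e ∷ x ∷ A).
  augments-swap : ∀ {e x A} → (Augments M e (x ∷ A) ⇔ Augments M e A) →
                  Augments M x (e ∷ A) ⇔ Augments M x A
  augments-swap {e} {x} {A} e-status with rk-∷ e A
  ... | inj₂ aug = augments-shift 1 (trans xe≡ex (Equivalence.from e-status aug)) aug
    where xe≡ex = rk-resp-↭ (swap x e ↭-refl)
  ... | inj₁ eq  = augments-shift 0 (trans xe≡ex (¬augments⇒rk-∷ ¬aug)) eq
    where
    xe≡ex = rk-resp-↭ (swap x e ↭-refl)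
    ¬aug : ¬ Augments M e (x ∷ A)
    ¬aug aug = 1+n≢n (trans (sym (Equivalence.to e-status aug)) eq)

  exchange-augments : ∀ {e x A} → Augments M e A → ¬ Augments M e (x ∷ A) → Augments M x A
  exchange-augments {e} {x} {A} aug ¬aug = ≤-antisym (rk-∷-≤ x A) (begin
    suc (rk M A)      ≡⟨ sym aug ⟩
    rk M (e ∷ A)      ≤⟨ rk-mono (∈-∷⁺ʳ (here refl) (there ∘ there)) ⟩
    rk M (e ∷ x ∷ A)  ≡⟨ ¬augments⇒rk-∷ ¬aug ⟩
    rk M (x ∷ A)      ∎)
    where open ≤-Reasoning

  exchange-spans : ∀ {e x A} → Augments M e A → ¬ Augments M e (x ∷ A) → ¬ Augments M x (e ∷ A)
  exchange-spans {e} {x} {A} aug ¬aug aug-x = 1+n≰n (begin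
    suc (suc (rk M A))  ≡⟨ cong suc (sym aug) ⟩
    suc (rk M (e ∷ A))  ≡⟨ sym aug-x ⟩
    rk M (x ∷ e ∷ A)    ≡⟨ rk-resp-↭ (swap x e ↭-refl) ⟩
    rk M (e ∷ x ∷ A)    ≡⟨ ¬augments⇒rk-∷ ¬aug ⟩
    rk M (x ∷ A)        ≤⟨ rk-∷-≤ x A ⟩
    suc (rk M A)        ∎)
    where open ≤-Reasoning

AgreeOff : ℕ → Matroid → Matroid → Set
AgreeOff e M N = ∀ A → e ∉ A → Indep M A ⇔ Indep N A

agreeOff-sym : ∀ {e M N} → AgreeOff e M N → AgreeOff e N M
agreeOff-sym agree A e∉A = ⇔-sym (agree A e∉A)

rk-agree : ∀ {e M N A} → AgreeOff e M N → e ∉ A → rk M A ≡ rk N A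
rk-agree {e} {M} {N} {A} agree e∉A = sym (rk-unique (witness , bound))
  where
  witness : ∃[ A' ] (A' ⊆ A × Indep N A' × length A' ≡ rk M A)
  open IsBasisOf (basisOf-isBasis {M} A)
  witness = basisOf M A , subset , Equivalence.to (agree _ (e∉A ∘ subset)) independent , maximum
  bound : ∀ A' → A' ⊆ A → Indep N A' → length A' ≤ rk M A
  bound A' A'⊆A iA' = rk-max (Equivalence.from (agree A' (e∉A ∘ A'⊆A)) iA') A'⊆A

augments-agree : ∀ {e M N x A} → AgreeOff e M N → e ∉ x ∷ A → Augments M x A ⇔ Augments N x A
augments-agree {e} {M} {N} {x} {A} agree e∉x∷A =
  mk⇔ (λ aug → trans (sym x∷A≡) (trans aug (cong suc A≡)))
      (λ aug → trans x∷A≡ (trans aug (cong suc (sym A≡))))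
  where
  x∷A≡ : rk M (x ∷ A) ≡ rk N (x ∷ A)
  x∷A≡ = rk-agree {M = M} {N = N} agree e∉x∷A
  A≡ : rk M A ≡ rk N A
  A≡ = rk-agree agree (e∉x∷A ∘ there)

augments-insert : ∀ {e N N⁺ x A A⁺} → AgreeOff e N⁺ N → e ∉ x ∷ A →
                  (Augments N⁺ e (x ∷ A) ⇔ Augments N⁺ e A) → A⁺ ↭ e ∷ A →
                  Augments N x A ⇔ Augments N⁺ x A⁺
augments-insert {e} {N} {N⁺} agree e∉x∷A e-status A⁺↭e∷A =
  mk⇔ (augments-resp-↭ (↭-sym A⁺↭e∷A)) (augments-resp-↭ A⁺↭e∷A)
    ⇔-∘ (⇔-sym (augments-swap e-status)
    ⇔-∘ augments-agree (agreeOff-sym {e} {N⁺} {N} agree) e∉x∷A)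

module _ {M : Matroid} where

  isBase-length : ∀ {B J} → IsBase M B → Indep M J → length J ≤ length B
  isBase-length {B} {J} (iB , maximal) iJ with length J ≤? length B
  ... | yes ≤B = ≤B
  ... | no  ≰B with indep-exch M iB iJ (≰⇒> ≰B)
  ... | x , _ , x∉B , ix∷B = contradiction (maximal (x ∷ B) ix∷B there (here refl)) x∉B

  basis-isBase : ∀ {A J} → IsBasisOf M A J → ground M ⊆ A → IsBase M J
  basis-isBase {A} {J} basis ground⊆A = independent , maximal
    where
    open IsBasisOf basis
    maximal : ∀ B' → Indep M B' → J ⊆ B' → B' ⊆ J
    maximal B' iB' J⊆B' {y} y∈B' with y ∈? J
    ... | yes y∈J = y∈J
    ... | no  y∉J = contradiction (rk-max iy∷J (ground⊆A ∘ indep-ground M iy∷J)) (<-irrefl maximum)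
      where
      iy∷J : Indep M (y ∷ J)
      iy∷J = indep-down M (∉⇒Unique-∷ y∉J (indep-unique M independent))
                            (∈-∷⁺ʳ y∈B' J⊆B') iB'

module _ {M : Matroid} {e x : ℕ} {A C : List ℕ} where

  augments-∷-spanned : ¬ Augments M e C → C ⊆ A → Augments M e (x ∷ A) ⇔ Augments M e A
  augments-∷-spanned ¬aug C⊆A =
    mk⇔ (λ aug → contradiction (augments-antitone (there ∘ C⊆A) aug) ¬aug)
        (λ aug → contradiction (augments-antitone C⊆A aug) ¬aug)

  augments-∷-free : Augments M e C → x ∷ A ⊆ C → Augments M e (x ∷ A) ⇔ Augments M e A
  augments-∷-free aug x∷A⊆C =
    mk⇔ (λ _ → augments-antitone (x∷A⊆C ∘ there) aug) (λ _ → augments-antitone x∷A⊆C aug)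

-- Greedy tables

Item : Set
Item = ℕ × ℕ

record Entry : Set where
  constructor entry
  field
    item   : Item
    inBase : Bool

open Entry public

elem : Entry → ℕ
elem = proj₁ ∘ item

wt : Entry → ℕ
wt = proj₂ ∘ item

items : List Entry → List Item
items = map item

elems : List Entry → List ℕ
elems = map elem

base : List Entry → List ℕ
base R = map elem (filterᵇ inBase R)

elems-shift : ∀ X p Y → elems (X ++ p ∷ Y) ↭ elem p ∷ elems (X ++ Y)
elems-shift X p Y = begin
  elems (X ++ p ∷ Y)             ≡⟨ map-++ elem X (p ∷ Y) ⟩
  elems X ++ elem p ∷ elems Y    ↭⟨ shift (elem p) (elems X) (elems Y) ⟩
  elem p ∷ elems X ++ elems Y    ≡⟨ cong (elem p ∷_) (map-++ elem X Y) ⟨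
  elem p ∷ elems (X ++ Y)        ∎
  where open PermutationReasoning

-- Tables list the elements by decreasing weight (WellFormed.sorted), so the entries after p are
-- the lighter ones.
data Greedy (M : Matroid) : List Entry → Set where
  []  : Greedy M []
  _∷_ : ∀ {p R} → (T (inBase p) ⇔ Augments M (elem p) (elems R)) → Greedy M R → Greedy M (p ∷ R)

module _ {M : Matroid} where

  greedy-basis : ∀ {R} → Greedy M R → IsBasisOf M (elems R) (base R)
  greedy-basis [] = record { independent = indep-[] M ; subset = λ () ; maximum = sym rk-[] }
  greedy-basis {entry i true ∷ R} (status ∷ g) = record
    { independent = basis-∷ (greedy-basis g) aug
    ; subset      = ∈-∷⁺ʳ (here refl) (there ∘ subset)
    ; maximum     = trans (cong suc maximum) (sym aug)
    }
    where
    open IsBasisOf (greedy-basis g)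
    aug = Equivalence.to status _
  greedy-basis {entry i false ∷ R} (status ∷ g) = record
    { independent = independent
    ; subset      = there ∘ subset
    ; maximum     = trans maximum (sym (¬augments⇒rk-∷ (Equivalence.from status)))
    }
    where open IsBasisOf (greedy-basis g)

  greedy-rank : ∀ {R} → Greedy M R → rk M (elems R) ≡ length (base R)
  greedy-rank g = sym (IsBasisOf.maximum (greedy-basis g))

  greedy-++⁻ʳ : ∀ X {Y} → Greedy M (X ++ Y) → Greedy M Y
  greedy-++⁻ʳ []      g       = g
  greedy-++⁻ʳ (_ ∷ X) (_ ∷ g) = greedy-++⁻ʳ X g

augments-cong : ∀ {M x A B} → A ≡ B → Augments M x A ⇔ Augments M x B
augments-cong refl = mk⇔ id id

greedy-agree : ∀ {e M N R} → AgreeOff e M N → e ∉ elems R → Greedy M R → Greedy N R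
greedy-agree agree e∉R []             = []
greedy-agree agree e∉R (status ∷ g) =
  augments-agree agree e∉R ⇔-∘ status ∷ greedy-agree agree (e∉R ∘ there) g

greedy-++ : ∀ {M N} X {Y Y'} →
            (∀ {x B} → x ∷ B ⊆ elems X →
                       Augments M x (B ++ elems Y) ⇔ Augments N x (B ++ elems Y')) →
            Greedy M (X ++ Y) → Greedy N Y' → Greedy N (X ++ Y')
greedy-++ []      same g            g' = g'
greedy-++ (p ∷ X) {Y} {Y'} same (status ∷ g) g' =
  (augments-cong (sym (map-++ elem X Y'))
    ⇔-∘ (same id ⇔-∘ (augments-cong (map-++ elem X Y) ⇔-∘ status)))
  ∷ greedy-++ X (λ x∷B⊆X → same (there ∘ x∷B⊆X)) g g'

⊆-elems-++ : ∀ {Z} X Y → Z ⊆ elems X → Z ++ elems Y ⊆ elems (X ++ Y)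
⊆-elems-++ X Y Z⊆X = ⊆-trans (++⁺ˡ (elems Y) Z⊆X) (⊆-reflexive (sym (map-++ elem X Y)))

elems-++⁺ʳ : ∀ X Y → elems Y ⊆ elems (X ++ Y)
elems-++⁺ʳ X Y = ⊆-trans (xs⊆ys++xs (elems Y) (elems X)) (⊆-reflexive (sym (map-++ elem X Y)))

module _ {e N N⁺} (agree : AgreeOff e N⁺ N) (X : List Entry) {Y Y⁺ : List Entry}
         (e∉X++Y : e ∉ elems (X ++ Y)) (Y⁺↭e∷Y : elems Y⁺ ↭ e ∷ elems Y)
         (e-status : ∀ {y B} → y ∷ B ⊆ elems X →
                     Augments N⁺ e (y ∷ B ++ elems Y) ⇔ Augments N⁺ e (B ++ elems Y))
         where

  private
    same : ∀ {y B} → y ∷ B ⊆ elems X →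
           Augments N y (B ++ elems Y) ⇔ Augments N⁺ y (B ++ elems Y⁺)
    same {y} {B} y∷B⊆X =
      augments-insert agree (e∉X++Y ∘ ⊆-elems-++ X Y y∷B⊆X) (e-status y∷B⊆X)
                      (↭-trans (++⁺ˡ-↭ B Y⁺↭e∷Y) (shift e B (elems Y)))

  greedy-prefix-insert : Greedy N (X ++ Y) → Greedy N⁺ Y⁺ → Greedy N⁺ (X ++ Y⁺)
  greedy-prefix-insert = greedy-++ X same

  greedy-prefix-delete : Greedy N⁺ (X ++ Y⁺) → Greedy N Y → Greedy N (X ++ Y)
  greedy-prefix-delete = greedy-++ X (⇔-sym ∘ same)

-- Minimum weight

module _ {A : Set} (f : A → ℕ) {P Q : Pred A 0ℓ} (P? : Decidable P) (Q? : Decidable Q) where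

  private
    #P #Q ΣP ΣQ : List A → ℕ
    #P xs = length (filter P? xs)
    #Q xs = length (filter Q? xs)
    ΣP xs = sum (map f (filter P? xs))
    ΣQ xs = sum (map f (filter Q? xs))

    raise-bound : ∀ {a b c d m₀ m} → a + c * m₀ ≤ b + d * m₀ → c ≤ d → m₀ ≤ m →
                  a + c * m ≤ b + d * m
    raise-bound {a} {b} {c} {d} {m₀} {m} le c≤d m₀≤m = begin
      a + c * m                ≡⟨ cong (λ k → a + c * k) (sym m₀+k≡m) ⟩
      a + c * (m₀ + k)         ≡⟨ cong (a +_) (*-distribˡ-+ c m₀ k) ⟩
      a + (c * m₀ + c * k)     ≡⟨ sym (+-assoc a _ _) ⟩
      (a + c * m₀) + c * k     ≤⟨ +-mono-≤ le (*-monoˡ-≤ k c≤d) ⟩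
      (b + d * m₀) + d * k     ≡⟨ +-assoc b _ _ ⟩
      b + (d * m₀ + d * k)     ≡⟨ cong (b +_) (sym (*-distribˡ-+ d m₀ k)) ⟩
      b + d * (m₀ + k)         ≡⟨ cong (λ k → b + d * k) m₀+k≡m ⟩
      b + d * m                ∎
      where
      open ≤-Reasoning
      k = m ∸ m₀
      m₀+k≡m : m₀ + k ≡ m
      m₀+k≡m = m+[n∸m]≡n m₀≤m

    -- Abel summation: raising the bound m from one weight to the next heavier one adds
    -- (#P - #Q) times the difference, which is non-negative by dominance.
    balance : ∀ {xs} m → All (λ a → f a ≤ m) xs → AllPairs (λ a b → f b ≤ f a) xs →
              (∀ ys zs → ys ++ zs ≡ xs → #Q zs ≤ #P zs) →
              ΣP xs + #Q xs * m ≤ ΣQ xs + #P xs * m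
    balance {[]}     m _           _              _         = z≤n
    balance {x ∷ xs} m (fx≤m ∷ _) (x≥xs ∷ sorted) dominated =
      raise-bound balanced-at-v (dominated [] (x ∷ xs) refl) fx≤m
      where
      v = f x
      ih : ΣP xs + #Q xs * v ≤ ΣQ xs + #P xs * v
      ih = balance v x≥xs sorted (λ ys zs eq → dominated (x ∷ ys) zs (cong (x ∷_) eq))
      open ≤-Reasoning
      balanced-at-v : ΣP (x ∷ xs) + #Q (x ∷ xs) * v ≤ ΣQ (x ∷ xs) + #P (x ∷ xs) * v
      balanced-at-v with P? x | Q? x
      ... | yes _ | yes _ = begin
        (v + ΣP xs) + (v + #Q xs * v)  ≡⟨ interchange v _ v _ ⟩
        (v + v) + (ΣP xs + #Q xs * v)  ≤⟨ +-monoʳ-≤ (v + v) ih ⟩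
        (v + v) + (ΣQ xs + #P xs * v)  ≡⟨ interchange v v _ _ ⟩
        (v + ΣQ xs) + (v + #P xs * v)  ∎
      ... | yes _ | no _ = begin
        (v + ΣP xs) + #Q xs * v        ≡⟨ +-assoc v _ _ ⟩
        v + (ΣP xs + #Q xs * v)        ≤⟨ +-monoʳ-≤ v ih ⟩
        v + (ΣQ xs + #P xs * v)        ≡⟨ x∙yz≈y∙xz v (ΣQ xs) _ ⟩
        ΣQ xs + (v + #P xs * v)        ∎
      ... | no _ | yes _ = begin
        ΣP xs + (v + #Q xs * v)        ≡⟨ x∙yz≈y∙xz (ΣP xs) v _ ⟩
        v + (ΣP xs + #Q xs * v)        ≤⟨ +-monoʳ-≤ v ih ⟩
        v + (ΣQ xs + #P xs * v)        ≡⟨ sym (+-assoc v _ _) ⟩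
        (v + ΣQ xs) + #P xs * v        ∎
      ... | no _ | no _ = ih

  sum-filter-dominated : ∀ {xs} → AllPairs (λ a b → f b ≤ f a) xs →
                         (∀ ys zs → ys ++ zs ≡ xs → #Q zs ≤ #P zs) → #P xs ≤ #Q xs →
                         ΣP xs ≤ ΣQ xs
  sum-filter-dominated {[]}     _                        _         _       = z≤n
  sum-filter-dominated {x ∷ xs} sorted@(x≥xs ∷ _) dominated #P≤#Q =
    +-cancelʳ-≤ (#Q (x ∷ xs) * f x) _ _ (begin
      ΣP (x ∷ xs) + #Q (x ∷ xs) * f x  ≤⟨ balance (f x) (≤-refl ∷ x≥xs) sorted dominated ⟩
      ΣQ (x ∷ xs) + #P (x ∷ xs) * f x  ≤⟨ +-monoʳ-≤ _ (*-monoˡ-≤ (f x) #P≤#Q) ⟩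
      ΣQ (x ∷ xs) + #Q (x ∷ xs) * f x  ∎)
    where open ≤-Reasoning

weight-elems : ∀ w {S} → All (λ p → wt p ≡ w (elem p)) S → weight w (elems S) ≡ sum (map wt S)
weight-elems w []      = refl
weight-elems w (eq ∷ eqs) = cong₂ _+_ (sym eq) (weight-elems w eqs)

module _ {M : Matroid} {w : Weighting} {R : List Entry} where

  greedy-minBase : Unique (elems R) → ground M ⊆ elems R → All (λ p → wt p ≡ w (elem p)) R →
                   AllPairs (λ p q → wt q ≤ wt p) R → Greedy M R → IsMinBase M w (base R)
  greedy-minBase distinct spanning weighted sorted g = isBase , minimal
    where
    isBase : IsBase M (base R)
    isBase = basis-isBase (greedy-basis g) spanning

    minimal : ∀ B' → IsBase M B' → weight w (base R) ≤ weight w B'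
    minimal B' isBase' = begin
      weight w (base R)                   ≡⟨ weight-elems w (All.filter⁺ (T? ∘ inBase) weighted) ⟩
      sum (map wt (filterᵇ inBase R))     ≤⟨ sum-filter-dominated wt (T? ∘ inBase) in-B'? sorted
                                                                  (dominated g distinct′) total ⟩
      sum (map wt (filter in-B'? R))      ≡⟨ weight-elems w (All.filter⁺ in-B'? weighted) ⟨
      weight w (elems (filter in-B'? R))  ≤⟨ weight-mono w (unique-in-B' distinct′) (in-B'⊆B' R) ⟩
      weight w B'                         ∎
      where
      open ≤-Reasoning
      iB' = proj₁ isBase'
      base-indep = IsBasisOf.independent (greedy-basis g)
      in-B'? = λ p → elem p ∈? B'
      distinct′ : AllPairs (_≢_ on elem) R
      distinct′ = AllPairs.map⁻ distinct

      unique-in-B' : ∀ {S} → AllPairs (_≢_ on elem) S → Unique (elems (filter in-B'? S))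
      unique-in-B' = AllPairs.map⁺ ∘ AllPairs.filter⁺ in-B'?

      in-B'⊆B' : ∀ S → elems (filter in-B'? S) ⊆ B'
      in-B'⊆B' S y∈ with ∈-map⁻ elem y∈
      ... | p , p∈ , refl = proj₂ (∈-filter⁻ in-B'? {xs = S} p∈)

      counts : ∀ {S} → Greedy M S → AllPairs (_≢_ on elem) S →
               length (filter in-B'? S) ≤ length (filterᵇ inBase S)
      counts {S} gS dS = begin
        length (filter in-B'? S)         ≡⟨ sym (length-map elem (filter in-B'? S)) ⟩
        length (elems (filter in-B'? S)) ≤⟨ rk-max (indep-down M (unique-in-B' dS) (in-B'⊆B' S) iB')
                                                   (map⁺-⊆ elem (filter-⊆ in-B'? S)) ⟩
        rk M (elems S)                   ≡⟨ greedy-rank gS ⟩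
        length (base S)                  ≡⟨ length-map elem (filterᵇ inBase S) ⟩
        length (filterᵇ inBase S)        ∎

      dominated : ∀ {S} → Greedy M S → AllPairs (_≢_ on elem) S →
                  ∀ ys zs → ys ++ zs ≡ S → length (filter in-B'? zs) ≤ length (filterᵇ inBase zs)
      dominated gS       dS       []       _ refl = counts gS dS
      dominated (_ ∷ gS) (_ ∷ dS) (_ ∷ ys) zs refl = dominated gS dS ys zs refl

      total : length (filterᵇ inBase R) ≤ length (filter in-B'? R)
      total = begin
        length (filterᵇ inBase R)        ≡⟨ sym (length-map elem (filterᵇ inBase R)) ⟩
        length (base R)                  ≤⟨ isBase-length {M} isBase' base-indep ⟩
        length B'                        ≤⟨ length-mono (indep-unique M iB') B'⊆ ⟩
        length (elems (filter in-B'? R)) ≡⟨ length-map elem (filter in-B'? R) ⟩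
        length (filter in-B'? R)         ∎
        where
        B'⊆ : B' ⊆ elems (filter in-B'? R)
        B'⊆ {y} y∈B' with ∈-map⁻ elem (spanning (indep-ground M iB' y∈B'))
        ... | p , p∈R , refl = ∈-map⁺ elem (∈-filter⁺ in-B'? p∈R y∈B')

data Query (X : Set) : Set where
  return : X → Query X
  query  : List ℕ → (ℕ → Query X) → Query X

module _ {X Y : Set} where

  _>>=_ : Query X → (X → Query Y) → Query Y
  return x  >>= f = f x
  query A k >>= f = query A (λ r → k r >>= f)

  _<$>_ : (X → Y) → Query X → Query Y
  f <$> m = m >>= (return ∘ f)

eval : ∀ {X} → Matroid → Query X → X
eval M (return x)  = x
eval M (query A k) = eval M (k (rk M A))

cost : ∀ {X} → Matroid → Query X → ℕ
cost M (return _)  = 0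
cost M (query A k) = suc (cost M (k (rk M A)))

module _ {X Y : Set} (M : Matroid) where

  eval->>= : ∀ (m : Query X) (f : X → Query Y) → eval M (m >>= f) ≡ eval M (f (eval M m))
  eval->>= (return x)  f = refl
  eval->>= (query A k) f = eval->>= (k (rk M A)) f

  cost->>= : ∀ (m : Query X) (f : X → Query Y) → cost M (m >>= f) ≡ cost M m + cost M (f (eval M m))
  cost->>= (return x)  f = refl
  cost->>= (query A k) f = cong suc (cost->>= (k (rk M A)) f)

  eval-<$> : ∀ (f : X → Y) m → eval M (f <$> m) ≡ f (eval M m)
  eval-<$> f m = eval->>= m (return ∘ f)

  cost-<$> : ∀ (f : X → Y) m → cost M (f <$> m) ≡ cost M m
  cost-<$> f m = trans (cost->>= m (return ∘ f)) (+-identityʳ _)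

realize : ∀ {S} → (S → List ℕ) → Query S → Proc S
realize out (return s)  = done s (out s)
realize out (query A k) = ask A (realize out ∘ k)

module _ {S : Set} (M : Matroid) (out : S → List ℕ) where

  realize-runs : ∀ m → Runs M (realize out m) (eval M m) (out (eval M m)) (cost M m)
  realize-runs (return s)  = run-done
  realize-runs (query A k) = run-ask (rk-isRank A) (realize-runs (k (rk M A)))

  realize-deterministic : ∀ m {s B q} → Runs M (realize out m) s B q → s ≡ eval M m
  realize-deterministic (return s)  run-done = refl
  realize-deterministic (query A k) (run-ask isRank runs) with rk-unique {M} isRank
  ... | refl = realize-deterministic (k (rk M A)) runs

-- Binary search

data Cut (A : Set) : Set where
  whole : Cut A
  at    : List A → A → List A → Cut A

module _ {A : Set} where

  CutSpec : (List A → Set) → List A → Cut A → Set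
  CutSpec Pass S whole      = Pass S
  CutSpec Pass S (at L u V) = S ≡ L ++ u ∷ V × ¬ Pass (u ∷ V) × Pass V

  extendRight : List A → Cut A → Cut A
  extendRight Z whole      = whole
  extendRight Z (at L u V) = at L u (V ++ Z)

  extendLeft : List A → A → List A → Cut A → Cut A
  extendLeft L m R whole      = at L m R
  extendLeft L m R (at P u V) = at (L ++ m ∷ P) u V

  extendRight-spec : ∀ {Pass} L Z c → CutSpec (Pass ∘ (_++ Z)) L c →
                     CutSpec Pass (L ++ Z) (extendRight Z c)
  extendRight-spec L Z whole      pass                    = pass
  extendRight-spec L Z (at P u V) (refl , ¬pass-u , pass) = ++-assoc P (u ∷ V) Z , ¬pass-u , pass

  extendLeft-spec : ∀ {Pass} L m R c → ¬ Pass (m ∷ R) → CutSpec Pass R c →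
                    CutSpec Pass (L ++ m ∷ R) (extendLeft L m R c)
  extendLeft-spec L m R whole      ¬pass-m pass                    = refl , ¬pass-m , pass
  extendLeft-spec L m R (at P u V) _       (refl , ¬pass-u , pass) =
    sym (++-assoc L (m ∷ P) (u ∷ V)) , ¬pass-u , pass

  halve : ℕ → A → List A → List A × A × List A
  halve zero    x xs       = [] , x , xs
  halve (suc h) x []       = [] , x , []
  halve (suc h) x (y ∷ ys) with halve h y ys
  ... | L , m , R = x ∷ L , m , R

  halve-spec : ∀ h x xs → h ≤ length xs → let (L , m , R) = halve h x xs in
               x ∷ xs ≡ L ++ m ∷ R × length L ≡ h × length R ≡ length xs ∸ h
  halve-spec zero    x xs       _         = refl , refl , refl
  halve-spec (suc h) x (y ∷ ys) (s≤s h≤) with halve h y ys | halve-spec h y ys h≤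
  ... | L , m , R | y∷ys≡ , |L| , |R| = cong (x ∷_) y∷ys≡ , cong suc |L| , |R|

⌊n/2⌋<a : ∀ {n a} → n < 2 * a → ⌊ n /2⌋ < a
⌊n/2⌋<a {n} {a} n<2a = ≰⇒> λ a≤⌊n/2⌋ → <⇒≱ n<2a (begin
  a + (a + 0)        ≡⟨ cong (a +_) (+-identityʳ a) ⟩
  a + a              ≤⟨ +-mono-≤ a≤⌊n/2⌋ (≤-trans a≤⌊n/2⌋ (⌊n/2⌋≤⌈n/2⌉ n)) ⟩
  ⌊ n /2⌋ + ⌈ n /2⌉ ≡⟨ ⌊n/2⌋+⌈n/2⌉≡n n ⟩
  n                  ∎)
  where open ≤-Reasoning

module _ {A : Set} where

  halve-split : ∀ {k} x (xs : List A) → length (x ∷ xs) < 2 ^ suc k →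
                let (L , m , R) = halve ⌊ length xs /2⌋ x xs in
                x ∷ xs ≡ L ++ m ∷ R × length L < 2 ^ k × length R < 2 ^ k
  halve-split {k} x xs |S|<2^k+1
    with halve ⌊ length xs /2⌋ x xs | halve-spec ⌊ length xs /2⌋ x xs (⌊n/2⌋≤n (length xs))
  ... | L , m , R | S≡ , |L|≡ , |R|≡ =
    S≡ , ≤-<-trans (≤-trans (≤-reflexive |L|≡) (⌊n/2⌋-mono (n≤1+n (length xs)))) half<2^k
       , ≤-<-trans (≤-reflexive |R|≡⌈⌉) half<2^k
    where
    n = length xs
    half<2^k : ⌊ suc n /2⌋ < 2 ^ k
    half<2^k = ⌊n/2⌋<a |S|<2^k+1
    |R|≡⌈⌉ : length R ≡ ⌈ n /2⌉
    |R|≡⌈⌉ = begin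
      length R                      ≡⟨ |R|≡ ⟩
      n ∸ ⌊ n /2⌋                   ≡⟨ cong (_∸ ⌊ n /2⌋) (⌊n/2⌋+⌈n/2⌉≡n n) ⟨
      ⌊ n /2⌋ + ⌈ n /2⌉ ∸ ⌊ n /2⌋  ≡⟨ m+n∸m≡n ⌊ n /2⌋ ⌈ n /2⌉ ⟩
      ⌈ n /2⌉                       ∎
      where open ≡-Reasoning

  search : ℕ → (List A → Query Bool) → List A → Query (Cut A)
  probe  : ℕ → (List A → Query Bool) → List A × A × List A → Query (Cut A)
  narrow : ℕ → (List A → Query Bool) → List A → A → List A → Bool → Query (Cut A)

  search zero    test _        = return whole
  search (suc k) test []       = return whole
  search (suc k) test (x ∷ xs) = probe k test (halve ⌊ length xs /2⌋ x xs)

  probe k test (L , m , R) = test (m ∷ R) >>= narrow k test L m R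

  narrow k test L m R true  = extendRight (m ∷ R) <$> search k (test ∘ (_++ m ∷ R)) L
  narrow k test L m R false = extendLeft L m R <$> search k test R

  module _ (M : Matroid) where

    -- The test need not be monotone: it passes on [], so a cut always exists.
    search-correct : ∀ k test S → length S < 2 ^ k → T (eval M (test [])) →
                     CutSpec (T ∘ eval M ∘ test) S (eval M (search k test S))
    probe-correct  : ∀ k test L m R → length L < 2 ^ k → length R < 2 ^ k → T (eval M (test [])) →
                     CutSpec (T ∘ eval M ∘ test) (L ++ m ∷ R) (eval M (probe k test (L , m , R)))

    search-correct zero    test []       _          pass[] = pass[]
    search-correct zero    test (_ ∷ _)  (s≤s ())   _
    search-correct (suc k) test []       _          pass[] = pass[]
    search-correct (suc k) test (x ∷ xs) |S|<2^k+1 pass[]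
      with halve ⌊ length xs /2⌋ x xs | halve-split {k = k} x xs |S|<2^k+1
    ... | L , m , R | S≡ , |L|<2^k , |R|<2^k =
      subst (λ S → CutSpec (T ∘ eval M ∘ test) S (eval M (probe k test (L , m , R)))) (sym S≡)
            (probe-correct k test L m R |L|<2^k |R|<2^k pass[])

    probe-correct k test L m R |L|<2^k |R|<2^k pass[]
      rewrite eval->>= M (test (m ∷ R)) (narrow k test L m R)
      with eval M (test (m ∷ R)) in pass-m
    ... | true
      rewrite eval-<$> M (extendRight (m ∷ R)) (search k (test ∘ (_++ m ∷ R)) L) =
      extendRight-spec {Pass = T ∘ eval M ∘ test} L (m ∷ R)
                       (eval M (search k (test ∘ (_++ m ∷ R)) L))
        (search-correct k (test ∘ (_++ m ∷ R)) L |L|<2^k (subst T (sym pass-m) _))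
    ... | false
      rewrite eval-<$> M (extendLeft L m R) (search k test R) =
      extendLeft-spec {Pass = T ∘ eval M ∘ test} L m R (eval M (search k test R))
        (subst T pass-m) (search-correct k test R |R|<2^k pass[])

    search-cost : ∀ k test S → (∀ V → cost M (test V) ≤ 1) → cost M (search k test S) ≤ k
    narrow-cost : ∀ k test L m R → (∀ V → cost M (test V) ≤ 1) →
                  ∀ pass → cost M (narrow k test L m R pass) ≤ k

    search-cost zero    test _        _     = z≤n
    search-cost (suc k) test []       _     = z≤n
    search-cost (suc k) test (x ∷ xs) test≤1 with halve ⌊ length xs /2⌋ x xs
    ... | L , m , R rewrite cost->>= M (test (m ∷ R)) (narrow k test L m R) =
      +-mono-≤ (test≤1 (m ∷ R)) (narrow-cost k test L m R test≤1 (eval M (test (m ∷ R))))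

    narrow-cost k test L m R test≤1 true
      rewrite cost-<$> M (extendRight (m ∷ R)) (search k (test ∘ (_++ m ∷ R)) L) =
      search-cost k (test ∘ (_++ m ∷ R)) L (test≤1 ∘ (_++ m ∷ R))
    narrow-cost k test L m R test≤1 false
      rewrite cost-<$> M (extendLeft L m R) (search k test R) =
      search-cost k test R test≤1

-- The rank of the lighter part V ++ Lo is read off its base entries, so each test is one query.
insertTest : ℕ → List Entry → List Entry → Query Bool
insertTest e Lo V = query (e ∷ elems (V ++ Lo)) λ r → return (r ≡ᵇ suc (length (base (V ++ Lo))))

deleteTest : Entry → List Entry → List Entry → Query Bool
deleteTest p Lo V = query (elems (V ++ Lo)) λ r → return (suc r ≡ᵇ length (base (V ++ p ∷ Lo)))

relabel : Bool → List Entry → Cut Entry → List Entry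
relabel b S whole      = S
relabel b S (at L u V) = L ++ record u { inBase = b } ∷ V

insertBetween : ℕ → ℕ → ℕ → List Entry → List Entry → Query (List Entry)
insertBetween k e x Hi Lo = insertTest e Lo [] >>= λ free →
  if free then (λ c → relabel false Hi c ++ entry (e , x) true ∷ Lo) <$> search k (insertTest e Lo) Hi
          else return (Hi ++ entry (e , x) false ∷ Lo)

deleteAt : ℕ → List Entry → List Entry → Query (List Entry)
deleteAt k Hi []       = return Hi  -- unreachable: the deleted element is in the table
deleteAt k Hi (p ∷ Lo) =
  if inBase p then (λ c → relabel true Hi c ++ Lo) <$> search k (deleteTest p Lo) Hi
              else return (Hi ++ Lo)

update : ℕ → List Entry → Update → Query (List Entry)
update k R (ins e x) = uncurry (insertBetween k e x) (span (λ p → x <? wt p) R)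
update k R (del e)   = uncurry (deleteAt k) (break (λ p → elem p ≟ e) R)

update-cost : ∀ M k R u → cost M (update k R u) ≤ suc k
update-cost M k R (ins e x) = uncurry insert-cost (span (λ p → x <? wt p) R)
  where
  insert-cost : ∀ Hi Lo → cost M (insertBetween k e x Hi Lo) ≤ suc k
  insert-cost Hi Lo with rk M (e ∷ elems Lo) ≡ᵇ suc (length (base Lo))
  ... | true  = s≤s (≤-trans (≤-reflexive (cost-<$> M _ (search k (insertTest e Lo) Hi)))
                             (search-cost M k (insertTest e Lo) Hi (λ _ → ≤-refl)))
  ... | false = s≤s z≤n
update-cost M k R (del e) = uncurry delete-cost (break (λ p → elem p ≟ e) R)
  where
  delete-cost : ∀ Hi Rest → cost M (deleteAt k Hi Rest) ≤ suc k
  delete-cost Hi []       = z≤n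
  delete-cost Hi (p ∷ Lo) with inBase p
  ... | true  = ≤-trans (≤-reflexive (cost-<$> M _ (search k (deleteTest p Lo) Hi)))
                        (≤-trans (search-cost M k (deleteTest p Lo) Hi (λ _ → ≤-refl)) (n≤1+n k))
  ... | false = z≤n

module _ (b : Bool) (L : List Entry) (u : Entry) (V : List Entry) where

  items-relabel : items (L ++ record u { inBase = b } ∷ V) ≡ items (L ++ u ∷ V)
  items-relabel = trans (map-++ item L _) (sym (map-++ item L _))

  elems-relabel : elems (L ++ record u { inBase = b } ∷ V) ≡ elems (L ++ u ∷ V)
  elems-relabel = trans (map-++ elem L _) (sym (map-++ elem L _))

module Insertion {M M' : Matroid} {e x : ℕ} (agree : AgreeOff e M' M) where

  private
    agree⁻ : AgreeOff e M M'
    agree⁻ = agreeOff-sym {e} {M'} {M} agree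

    e⁻ e⁺ : Entry
    e⁻ = entry (e , x) false
    e⁺ = entry (e , x) true

  insertTest-correct : ∀ V {Lo} → Greedy M (V ++ Lo) → e ∉ elems (V ++ Lo) →
                       T (eval M' (insertTest e Lo V)) ⇔ Augments M' e (elems (V ++ Lo))
  insertTest-correct V {Lo} g e∉ =
    mk⇔ (λ t → trans (≡ᵇ⇒≡ _ _ t) (cong suc count))
        (λ aug → ≡⇒≡ᵇ _ _ (trans aug (cong suc (sym count))))
    where
    count : length (base (V ++ Lo)) ≡ rk M' (elems (V ++ Lo))
    count = trans (sym (greedy-rank g)) (sym (rk-agree agree e∉))

  insert-spanned : ∀ Hi {Lo} → ¬ Augments M' e (elems Lo) → e ∉ elems (Hi ++ Lo) →
                   Greedy M (Hi ++ Lo) → Greedy M' (Hi ++ e⁻ ∷ Lo)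
  insert-spanned Hi {Lo} ¬aug e∉ g =
    greedy-prefix-insert agree Hi e∉ ↭-refl (λ _ → augments-∷-spanned ¬aug (xs⊆ys++xs _ _)) g
      (mk⇔ ⊥-elim ¬aug ∷ greedy-agree agree⁻ (e∉ ∘ elems-++⁺ʳ Hi Lo) (greedy-++⁻ʳ Hi g))

  insert-below : ∀ V {Lo} → Augments M' e (elems (V ++ Lo)) → e ∉ elems (V ++ Lo) →
                 Greedy M (V ++ Lo) → Greedy M' (V ++ e⁺ ∷ Lo)
  insert-below V {Lo} aug e∉ g =
    greedy-prefix-insert agree V e∉ ↭-refl (augments-∷-free aug ∘ ⊆-elems-++ V Lo) g
      (mk⇔ (λ _ → augments-antitone (elems-++⁺ʳ V Lo) aug) _
        ∷ greedy-agree agree⁻ (e∉ ∘ elems-++⁺ʳ V Lo) (greedy-++⁻ʳ V g))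

  insert-cut : ∀ P u V {Lo} → Augments M' e (elems (V ++ Lo)) →
               ¬ Augments M' e (elem u ∷ elems (V ++ Lo)) →
               e ∉ elems (P ++ u ∷ V ++ Lo) → Greedy M (P ++ u ∷ V ++ Lo) →
               Greedy M' (P ++ record u { inBase = false } ∷ V ++ e⁺ ∷ Lo)
  insert-cut P u V {Lo} aug ¬aug-u e∉ g with greedy-++⁻ʳ P g
  ... | _ ∷ gV =
    greedy-prefix-insert agree P e∉ (elems-shift (u ∷ V) e⁺ Lo)
                         (λ _ → augments-∷-spanned ¬aug-u (xs⊆ys++xs _ _)) g
      (mk⇔ ⊥-elim (exchange-spans aug ¬aug-u ∘ augments-resp-↭ (elems-shift V e⁺ Lo))
        ∷ insert-below V aug (e∉ ∘ elems-++⁺ʳ P (u ∷ V ++ Lo) ∘ there) gV)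

  insert-correct : ∀ k Hi Lo → length Hi < 2 ^ k → e ∉ elems (Hi ++ Lo) → Greedy M (Hi ++ Lo) →
                   let R' = eval M' (insertBetween k e x Hi Lo) in
                   Greedy M' R' × items R' ≡ items Hi ++ (e , x) ∷ items Lo
  insert-correct k Hi Lo |Hi|<2^k e∉ g with rk M' (e ∷ elems Lo) ≡ᵇ suc (length (base Lo)) in free
  ... | false = insert-spanned Hi spanned e∉ g , map-++ item Hi (e⁻ ∷ Lo)
    where
    spanned : ¬ Augments M' e (elems Lo)
    spanned = subst T free
            ∘ Equivalence.from (insertTest-correct [] (greedy-++⁻ʳ Hi g) (e∉ ∘ elems-++⁺ʳ Hi Lo))
  ... | true
    rewrite eval-<$> M' (λ c → relabel false Hi c ++ e⁺ ∷ Lo) (search k (insertTest e Lo) Hi)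
    with eval M' (search k (insertTest e Lo) Hi)
       | search-correct M' k (insertTest e Lo) Hi |Hi|<2^k (subst T (sym free) _)
  ...   | whole | pass =
    insert-below Hi (Equivalence.to (insertTest-correct Hi g e∉) pass) e∉ g , map-++ item Hi (e⁺ ∷ Lo)
  ...   | at P u V | refl , ¬pass-u , pass-V =
    subst (Greedy M') (sym (++-assoc P _ _)) (insert-cut P u V aug-V ¬aug-u e∉′ g′) ,
    trans (map-++ item (P ++ _ ∷ V) (e⁺ ∷ Lo)) (cong (_++ _) (items-relabel false P u V))
    where
    g′ : Greedy M (P ++ u ∷ V ++ Lo)
    g′ = subst (Greedy M) (++-assoc P _ _) g
    e∉′ : e ∉ elems (P ++ u ∷ V ++ Lo)
    e∉′ = subst (λ S → e ∉ elems S) (++-assoc P _ _) e∉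
    gu : Greedy M (u ∷ V ++ Lo)
    gu = greedy-++⁻ʳ P g′
    e∉u : e ∉ elems (u ∷ V ++ Lo)
    e∉u = e∉′ ∘ elems-++⁺ʳ P _
    aug-V : Augments M' e (elems (V ++ Lo))
    aug-V = Equivalence.to (insertTest-correct V (greedy-++⁻ʳ (u ∷ []) gu) (e∉u ∘ there)) pass-V
    ¬aug-u : ¬ Augments M' e (elem u ∷ elems (V ++ Lo))
    ¬aug-u = ¬pass-u ∘ Equivalence.from (insertTest-correct (u ∷ V) gu e∉u)

module Deletion {M M' : Matroid} {e : ℕ} (agree : AgreeOff e M' M) where

  private
    agree⁻ : AgreeOff e M M'
    agree⁻ = agreeOff-sym {e} {M'} {M} agree

  deleteTest-correct : ∀ V {c b Lo} → let p = entry (e , c) b in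
                       Greedy M (V ++ p ∷ Lo) → e ∉ elems (V ++ Lo) →
                       T (eval M' (deleteTest p Lo V)) ⇔ Augments M e (elems (V ++ Lo))
  deleteTest-correct V {c} {b} {Lo} g e∉ =
    mk⇔ (λ t → trans (sym count) (trans (sym (≡ᵇ⇒≡ _ _ t)) (cong suc rk≡)))
        (λ aug → ≡⇒≡ᵇ _ _ (trans (cong suc rk≡) (trans (sym aug) (sym count))))
    where
    count : length (base (V ++ entry (e , c) b ∷ Lo)) ≡ rk M (e ∷ elems (V ++ Lo))
    count = trans (sym (greedy-rank g)) (rk-resp-↭ (elems-shift V (entry (e , c) b) Lo))
    rk≡ : rk M' (elems (V ++ Lo)) ≡ rk M (elems (V ++ Lo))
    rk≡ = rk-agree agree e∉

  delete-spanned : ∀ Hi {p Lo} → elem p ≡ e → ¬ Augments M e (elems Lo) →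
                   e ∉ elems (Hi ++ Lo) → Greedy M (Hi ++ p ∷ Lo) → Greedy M' (Hi ++ Lo)
  delete-spanned Hi {Lo = Lo} refl ¬aug e∉ g with greedy-++⁻ʳ Hi g
  ... | _ ∷ gLo =
    greedy-prefix-delete agree⁻ Hi e∉ ↭-refl (λ _ → augments-∷-spanned ¬aug (xs⊆ys++xs _ _)) g
                         (greedy-agree agree⁻ (e∉ ∘ elems-++⁺ʳ Hi Lo) gLo)

  delete-above : ∀ V {p Lo} → elem p ≡ e → Augments M e (elems (V ++ Lo)) →
                 e ∉ elems (V ++ Lo) → Greedy M (V ++ p ∷ Lo) → Greedy M' (V ++ Lo)
  delete-above V {Lo = Lo} refl aug e∉ g with greedy-++⁻ʳ V g
  ... | _ ∷ gLo =
    greedy-prefix-delete agree⁻ V e∉ ↭-refl (augments-∷-free aug ∘ ⊆-elems-++ V Lo) g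
                         (greedy-agree agree⁻ (e∉ ∘ elems-++⁺ʳ V Lo) gLo)

  delete-cut : ∀ P u V {p Lo} → elem p ≡ e → Augments M e (elems (V ++ Lo)) →
               ¬ Augments M e (elem u ∷ elems (V ++ Lo)) →
               e ∉ elems (P ++ u ∷ V ++ Lo) → Greedy M (P ++ u ∷ V ++ p ∷ Lo) →
               Greedy M' (P ++ record u { inBase = true } ∷ V ++ Lo)
  delete-cut P u V {p} {Lo} refl aug ¬aug-u e∉ g with greedy-++⁻ʳ P g
  ... | _ ∷ gV =
    greedy-prefix-delete agree⁻ P (subst (e ∉_) (sym (elems-relabel true P u (V ++ Lo))) e∉)
                         (elems-shift (u ∷ V) p Lo)
                         (λ _ → augments-∷-spanned ¬aug-u (xs⊆ys++xs _ _)) g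
      (mk⇔ (λ _ → Equivalence.to (augments-agree agree⁻ e∉u) (exchange-augments aug ¬aug-u)) _
        ∷ delete-above V refl aug (e∉u ∘ there) gV)
    where
    e∉u : e ∉ elem u ∷ elems (V ++ Lo)
    e∉u = e∉ ∘ elems-++⁺ʳ P (u ∷ V ++ Lo)

  delete-correct : ∀ k Hi c b Lo → length Hi < 2 ^ k → e ∉ elems (Hi ++ Lo) →
                   Greedy M (Hi ++ entry (e , c) b ∷ Lo) →
                   let R' = eval M' (deleteAt k Hi (entry (e , c) b ∷ Lo)) in
                   Greedy M' R' × items R' ≡ items Hi ++ items Lo
  delete-correct k Hi c false Lo |Hi|<2^k e∉ g with greedy-++⁻ʳ Hi g
  ... | status ∷ _ = delete-spanned Hi refl (Equivalence.from status) e∉ g , map-++ item Hi Lo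
  delete-correct k Hi c true Lo |Hi|<2^k e∉ g with greedy-++⁻ʳ Hi g
  ... | status ∷ gLo
    rewrite eval-<$> M' (λ c → relabel true Hi c ++ Lo) (search k (deleteTest (entry (e , c) true) Lo) Hi)
    with eval M' (search k (deleteTest (entry (e , c) true) Lo) Hi)
       | search-correct M' k (deleteTest (entry (e , c) true) Lo) Hi |Hi|<2^k
           (Equivalence.from (deleteTest-correct [] {c} {true} (status ∷ gLo) (e∉ ∘ elems-++⁺ʳ Hi Lo))
                             (Equivalence.to status _))
  ...   | whole | pass =
    delete-above Hi refl (Equivalence.to (deleteTest-correct Hi g e∉) pass) e∉ g , map-++ item Hi Lo
  ...   | at P u V | refl , ¬pass-u , pass-V =
    subst (Greedy M') (sym (++-assoc P _ _)) (delete-cut P u V refl aug-V ¬aug-u e∉′ g′) ,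
    trans (map-++ item (P ++ _ ∷ V) Lo) (cong (_++ items Lo) (items-relabel true P u V))
    where
    g′ : Greedy M (P ++ u ∷ V ++ entry (e , c) true ∷ Lo)
    g′ = subst (Greedy M) (++-assoc P _ _) g
    e∉′ : e ∉ elems (P ++ u ∷ V ++ Lo)
    e∉′ = subst (λ S → e ∉ elems S) (++-assoc P _ _) e∉
    gu : Greedy M (u ∷ V ++ entry (e , c) true ∷ Lo)
    gu = greedy-++⁻ʳ P g′
    e∉u : e ∉ elems (u ∷ V ++ Lo)
    e∉u = e∉′ ∘ elems-++⁺ʳ P _
    aug-V : Augments M e (elems (V ++ Lo))
    aug-V = Equivalence.to (deleteTest-correct V (greedy-++⁻ʳ (u ∷ []) gu) (e∉u ∘ there)) pass-V
    ¬aug-u : ¬ Augments M e (elem u ∷ elems (V ++ Lo))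
    ¬aug-u = ¬pass-u ∘ Equivalence.from (deleteTest-correct (u ∷ V) gu e∉u)

module _ {A : Set} {R : A → A → Set} where

  allPairs-insert : ∀ xs {ys z} → AllPairs R (xs ++ ys) → All (λ x → R x z) xs → All (R z) ys →
                    AllPairs R (xs ++ z ∷ ys)
  allPairs-insert []       sorted           _           z-ys = z-ys ∷ sorted
  allPairs-insert (x ∷ xs) {ys} {z} (x-rest ∷ sorted) (xz ∷ xs-z) z-ys =
    All-resp-↭ (↭-sym (shift z xs ys)) (xz ∷ x-rest) ∷ allPairs-insert xs sorted xs-z z-ys

  allPairs-delete : ∀ xs {ys z} → AllPairs R (xs ++ z ∷ ys) → AllPairs R (xs ++ ys)
  allPairs-delete []       (_ ∷ sorted) = sorted
  allPairs-delete (x ∷ xs) {ys} {z} (x-rest ∷ sorted) =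
    All.tail (All-resp-↭ (shift z xs ys) x-rest) ∷ allPairs-delete xs sorted

record WellFormed (W : ℕ) (M : Matroid) (w : Weighting) (I : List Item) : Set where
  field
    distinct : Unique (map proj₁ I)
    covers   : ∀ y → y ∈ map proj₁ I ⇔ y ∈ ground M
    weighted : All (λ (y , c) → c ≡ w y) I
    bounded  : All (λ (_ , c) → 1 ≤ c × c ≤ W) I
    sorted   : AllPairs (λ (_ , c) (_ , d) → d ≤ c) I

Invariant : ℕ → Matroid → Weighting → List Entry → Set
Invariant W M w R = WellFormed W M w (items R) × Greedy M R

elems-items : ∀ R → elems R ≡ map proj₁ (items R)
elems-items = map-∘

invariant-minBase : ∀ {W M w R} → Invariant W M w R → IsMinBase M w (base R)
invariant-minBase {R = R} (wf , g) =
  greedy-minBase (subst Unique (sym (elems-items R)) distinct)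
                 (subst (_ ∈_) (sym (elems-items R)) ∘ Equivalence.from (covers _))
                 (All.map⁻ weighted) (AllPairs.map⁻ sorted) g
  where open WellFormed wf

setWeight-≢ : ∀ w {e x y} → y ≢ e → setWeight w e x y ≡ w y
setWeight-≢ w {e} {x} {y} y≢e with y ≡ᵇ e in eq
... | true  = contradiction (≡ᵇ⇒≡ y e (subst T (sym eq) _)) y≢e
... | false = refl

setWeight-≡ : ∀ w e x → setWeight w e x e ≡ x
setWeight-≡ w e x with e ≡ᵇ e in eq
... | true  = refl
... | false = contradiction (subst T eq (≡⇒≡ᵇ e e refl)) id

module _ {W : ℕ} {M : Matroid} {w : Weighting} where

  insert-wellFormed : ∀ {M' e x} Hi Lo → WellFormed W M w (Hi ++ Lo) → e ∉ ground M →
                      1 ≤ x → x ≤ W → IsInsertion M e M' →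
                      All (λ (_ , c) → x < c) Hi → All (λ (_ , c) → c ≤ x) Lo →
                      WellFormed W M' (setWeight w e x) (Hi ++ (e , x) ∷ Lo)
  insert-wellFormed {M'} {e} {x} Hi Lo wf e∉M 1≤x x≤W (ground-ins , _) Hi>x Lo≤x = record
    { distinct = Unique-resp-↭ (↭⇒↭ₛ (↭-sym to-front)) (All.¬Any⇒All¬ _ e∉ ∷ distinct)
    ; covers   = λ y → mk⇔ (Equivalence.from (ground-ins y) ∘ old-or-new ∘ ∈-resp-↭ to-front)
                           (∈-resp-↭ (↭-sym to-front) ∘ new-or-old ∘ Equivalence.to (ground-ins y))
    ; weighted = All-resp-↭ (↭-sym (shift (e , x) Hi Lo))
                            (sym (setWeight-≡ w e x) ∷ reweigh (Hi ++ Lo) e∉ weighted)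
    ; bounded  = All-resp-↭ (↭-sym (shift (e , x) Hi Lo)) ((1≤x , x≤W) ∷ bounded)
    ; sorted   = allPairs-insert Hi sorted (All.map <⇒≤ Hi>x) Lo≤x
    }
    where
    open WellFormed wf
    to-front : map proj₁ (Hi ++ (e , x) ∷ Lo) ↭ e ∷ map proj₁ (Hi ++ Lo)
    to-front = map⁺-↭ proj₁ (shift (e , x) Hi Lo)
    e∉ : e ∉ map proj₁ (Hi ++ Lo)
    e∉ = e∉M ∘ Equivalence.to (covers e)
    old-or-new : ∀ {y} → y ∈ e ∷ map proj₁ (Hi ++ Lo) → y ≡ e ⊎ y ∈ ground M
    old-or-new (here y≡e) = inj₁ y≡e
    old-or-new (there y∈) = inj₂ (Equivalence.to (covers _) y∈)
    new-or-old : ∀ {y} → y ≡ e ⊎ y ∈ ground M → y ∈ e ∷ map proj₁ (Hi ++ Lo)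
    new-or-old (inj₁ y≡e) = here y≡e
    new-or-old (inj₂ y∈M) = there (Equivalence.from (covers _) y∈M)
    reweigh : ∀ I → e ∉ map proj₁ I → All (λ (y , c) → c ≡ w y) I →
              All (λ (y , c) → c ≡ setWeight w e x y) I
    reweigh []      _  []          = []
    reweigh (_ ∷ I) e∉ (c≡ ∷ c≡s) =
      trans c≡ (sym (setWeight-≢ w (e∉ ∘ here ∘ sym))) ∷ reweigh I (e∉ ∘ there) c≡s

  delete-wellFormed : ∀ {M' e} Hi c Lo → WellFormed W M w (Hi ++ (e , c) ∷ Lo) → IsDeletion M e M' →
                      WellFormed W M' w (Hi ++ Lo)
  delete-wellFormed {M'} {e} Hi c Lo wf (ground-del , _) = record
    { distinct = distinct′
    ; covers   = λ y → mk⇔ (λ y∈ → Equivalence.from (ground-del y)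
                                  (Equivalence.to (covers y) (from-rest y∈) , λ { refl → e∉ y∈ }))
                           (λ y∈M' → let y∈M , y≢e = Equivalence.to (ground-del y) y∈M' in
                                     to-rest y≢e (Equivalence.from (covers y) y∈M))
    ; weighted = All.tail (All-resp-↭ (shift (e , c) Hi Lo) weighted)
    ; bounded  = All.tail (All-resp-↭ (shift (e , c) Hi Lo) bounded)
    ; sorted   = allPairs-delete Hi sorted
    }
    where
    open WellFormed wf
    to-front : map proj₁ (Hi ++ (e , c) ∷ Lo) ↭ e ∷ map proj₁ (Hi ++ Lo)
    to-front = map⁺-↭ proj₁ (shift (e , c) Hi Lo)
    front-distinct : Unique (e ∷ map proj₁ (Hi ++ Lo))
    front-distinct = Unique-resp-↭ (↭⇒↭ₛ to-front) distinct
    e∉ : e ∉ map proj₁ (Hi ++ Lo)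
    e∉ = Unique[x∷xs]⇒x∉xs front-distinct
    distinct′ : Unique (map proj₁ (Hi ++ Lo))
    distinct′ with front-distinct
    ... | _ ∷ d = d
    from-rest : ∀ {y} → y ∈ map proj₁ (Hi ++ Lo) → y ∈ map proj₁ (Hi ++ (e , c) ∷ Lo)
    from-rest = ∈-resp-↭ (↭-sym to-front) ∘ there
    to-rest : ∀ {y} → y ≢ e → y ∈ map proj₁ (Hi ++ (e , c) ∷ Lo) →
              y ∈ map proj₁ (Hi ++ Lo)
    to-rest y≢e y∈ with ∈-resp-↭ to-front y∈
    ... | here y≡e = contradiction y≡e y≢e
    ... | there y∈′ = y∈′

span-sorted : ∀ x R → AllPairs (λ p q → wt q ≤ wt p) R →
              let (Hi , Lo) = span (λ p → x <? wt p) R in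
              Hi ++ Lo ≡ R × All (λ p → x < wt p) Hi × All (λ p → wt p ≤ x) Lo
span-sorted x []      _                = refl , [] , []
span-sorted x (p ∷ R) (p≥R ∷ sorted) with x <ᵇ wt p in x<ᵇp
... | true  = let R≡ , Hi>x , Lo≤x = span-sorted x R sorted in
              cong (p ∷_) R≡ , <ᵇ⇒< x (wt p) (subst T (sym x<ᵇp) _) ∷ Hi>x , Lo≤x
... | false = refl , [] , p≤x ∷ All.map (λ q≤p → ≤-trans q≤p p≤x) p≥R
  where
  p≤x : wt p ≤ x
  p≤x = ≮⇒≥ (subst T x<ᵇp ∘ <⇒<ᵇ)

break-elem : ∀ e R → e ∈ elems R → let (Hi , Rest) = break (λ p → elem p ≟ e) R in
             Hi ++ Rest ≡ R × ∃[ c ] ∃[ b ] ∃[ Lo ] Rest ≡ entry (e , c) b ∷ Lo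
break-elem e (p ∷ R) e∈ with elem p ≡ᵇ e in p≡ᵇe
... | true with ≡ᵇ⇒≡ (elem p) e (subst T (sym p≡ᵇe) _)
...   | refl = refl , wt p , inBase p , R , refl
break-elem e (p ∷ R) (here e≡p)  | false =
  contradiction (≡⇒≡ᵇ (elem p) e (sym e≡p)) (subst T p≡ᵇe)
break-elem e (p ∷ R) (there e∈R) | false =
  let R≡ , rest = break-elem e R e∈R in cong (p ∷_) R≡ , rest

prefix-length : ∀ {W M w} I J → WellFormed W M w (I ++ J) → length I ≤ length (ground M)
prefix-length {M = M} I J wf = begin
  length I                  ≤⟨ m≤m+n (length I) (length J) ⟩
  length I + length J       ≡⟨ sym (length-++ I) ⟩
  length (I ++ J)           ≡⟨ sym (length-map proj₁ (I ++ J)) ⟩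
  length (map proj₁ (I ++ J)) ≤⟨ length-mono distinct (Equivalence.to (covers _)) ⟩
  length (ground M)         ∎
  where
  open ≤-Reasoning
  open WellFormed wf

n<2^[1+⌊log₂n⌋] : ∀ n → n < 2 ^ suc ⌊log₂ n ⌋
n<2^[1+⌊log₂n⌋] n = ≰⇒> λ 2^≤n → 1+n≰n (begin
  suc ⌊log₂ n ⌋               ≡⟨ sym (⌊log₂[2^n]⌋≡n (suc ⌊log₂ n ⌋)) ⟩
  ⌊log₂ 2 ^ suc ⌊log₂ n ⌋ ⌋   ≤⟨ ⌊log₂⌋-mono-≤ 2^≤n ⟩
  ⌊log₂ n ⌋                   ∎)
  where open ≤-Reasoning

prefix-length<2^[1+⌊log₂n⌋] : ∀ {n W M w} Hi I → WellFormed W M w (items Hi ++ I) →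
                              length (ground M) ≤ n → length Hi < 2 ^ suc ⌊log₂ n ⌋
prefix-length<2^[1+⌊log₂n⌋] {n} {M = M} Hi I wf |M|≤n = begin-strict
  length Hi          ≡⟨ length-map item Hi ⟨
  length (items Hi)  ≤⟨ prefix-length (items Hi) I wf ⟩
  length (ground M)  ≤⟨ |M|≤n ⟩
  n                  <⟨ n<2^[1+⌊log₂n⌋] n ⟩
  2 ^ suc ⌊log₂ n ⌋  ∎
  where open ≤-Reasoning

elems-items-++ : ∀ X Y → elems (X ++ Y) ≡ map proj₁ (items X ++ items Y)
elems-items-++ X Y = trans (elems-items (X ++ Y)) (cong (map proj₁) (map-++ item X Y))

update-invariant : ∀ {n W M w R u M' w'} → Invariant W M w R → ValidUpdate n W M w u M' w' →
                   Invariant W M' w' (eval M' (update (suc ⌊log₂ n ⌋) R u))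
update-invariant {n} {M = M} {R = R} (wf , g)
                 (vins {M' = M'} {e = e} {x = x} e∉M 1≤x x≤W insertion |M'|≤n)
  with span (λ p → x <? wt p) R | span-sorted x R (AllPairs.map⁻ (WellFormed.sorted wf))
... | Hi , Lo | refl , Hi>x , Lo≤x = subst (WellFormed _ M' _) (sym (proj₂ correct)) wf′ , proj₁ correct
  where
  wf′ = insert-wellFormed (items Hi) (items Lo) (subst (WellFormed _ M _) (map-++ item Hi Lo) wf)
                          e∉M 1≤x x≤W insertion (All.map⁺ Hi>x) (All.map⁺ Lo≤x)
  e∉ : e ∉ elems (Hi ++ Lo)
  e∉ = e∉M ∘ Equivalence.to (WellFormed.covers wf e) ∘ subst (e ∈_) (elems-items (Hi ++ Lo))
  correct = Insertion.insert-correct (proj₂ insertion) (suc ⌊log₂ n ⌋) Hi Lo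
                                     (prefix-length<2^[1+⌊log₂n⌋] Hi _ wf′ |M'|≤n) e∉ g
update-invariant {n} {M = M} {R = R} (wf , g) (vdel {M' = M'} {e = e} e∈M deletion |M'|≤n)
  with break (λ p → elem p ≟ e) R
     | break-elem e R (subst (e ∈_) (sym (elems-items R)) (Equivalence.from (WellFormed.covers wf e) e∈M))
... | Hi , _ | refl , c , b , Lo , refl = subst (WellFormed _ M' _) (sym (proj₂ correct)) wf′ , proj₁ correct
  where
  wf′ = delete-wellFormed (items Hi) c (items Lo) (subst (WellFormed _ M _) (map-++ item Hi _) wf) deletion
  agree : AgreeOff e M' M
  agree A e∉A = mk⇔ (proj₁ ∘ Equivalence.to (proj₂ deletion A))
                    (λ i → Equivalence.from (proj₂ deletion A) (i , e∉A))
  e∉ : e ∉ elems (Hi ++ Lo)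
  e∉ e∈ = proj₂ (Equivalence.to (proj₁ deletion e) e∈M') refl
    where e∈M' = Equivalence.to (WellFormed.covers wf′ e) (subst (e ∈_) (elems-items-++ Hi Lo) e∈)
  correct = Deletion.delete-correct agree (suc ⌊log₂ n ⌋) Hi c b Lo
                                    (prefix-length<2^[1+⌊log₂n⌋] Hi _ wf′ |M'|≤n) e∉ g

-- At most n elements are heavier than the updated one, so suc ⌊log₂ n⌋ halvings suffice.
dynamicMinBase : ℕ → ℕ → Algorithm
dynamicMinBase n _ = record
  { State = List Entry
  ; init  = []
  ; step  = λ R u → realize base (update (suc ⌊log₂ n ⌋) R u)
  }

reachable-invariant : ∀ {n W M w R} → Reachable n W (dynamicMinBase n W) M w R → Invariant W M w R
reachable-invariant reach-init = record
  { distinct = [] ; covers = λ _ → mk⇔ id id ; weighted = [] ; bounded = [] ; sorted = [] } , []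
reachable-invariant {n} (reach-step {s = R} {u = u} {M' = M'} reach valid runs)
  rewrite realize-deterministic M' base (update (suc ⌊log₂ n ⌋) R u) runs =
  update-invariant (reachable-invariant reach) valid

valid⇒1≤W : ∀ {n W M w R u M' w'} → Invariant W M w R → ValidUpdate n W M w u M' w' → 1 ≤ W
valid⇒1≤W _        (vins _ 1≤x x≤W _ _) = ≤-trans 1≤x x≤W
valid⇒1≤W (wf , _) (vdel {e = e} e∈M _ _)
  with ∈-map⁻ proj₁ (Equivalence.from (WellFormed.covers wf e) e∈M)
... | _ , i∈ , refl = let 1≤c , c≤W = All.lookup (WellFormed.bounded wf) i∈ in ≤-trans 1≤c c≤W

2+⌊log₂n⌋≤2*[1+⌊log₂Wn⌋] : ∀ {W} n → 1 ≤ W →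
                            suc (suc ⌊log₂ n ⌋) ≤ 2 * suc ⌊log₂ (W * n) ⌋
2+⌊log₂n⌋≤2*[1+⌊log₂Wn⌋] {W} n 1≤W = begin
  suc (suc ⌊log₂ n ⌋)  ≤⟨ s≤s (s≤s (⌊log₂⌋-mono-≤ n≤Wn)) ⟩
  suc (suc L)          ≤⟨ s≤s (m≤n+m (suc L) L) ⟩
  suc L + suc L        ≡⟨ cong (suc L +_) (sym (+-identityʳ (suc L))) ⟩
  2 * suc L            ∎
  where
  open ≤-Reasoning
  L = ⌊log₂ (W * n) ⌋
  n≤Wn : n ≤ W * n
  n≤Wn = ≤-trans (≤-reflexive (sym (*-identityˡ n))) (*-monoˡ-≤ n 1≤W)

proposition1p1 :
    Σ ℕ λ c → Σ (ℕ → ℕ → Algorithm) λ alg →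
      ∀ n W {M w s} → Reachable n W (alg n W) M w s →
      ∀ {u M' w'} → ValidUpdate n W M w u M' w' →
      Σ[ s' ∈ State (alg n W) ] Σ[ B ∈ List ℕ ] Σ[ q ∈ ℕ ]
        (Runs M' (step (alg n W) s u) s' B q ×
         q ≤ c * suc ⌊log₂ (W * n) ⌋ ×
         IsMinBase M' w' B)
proposition1p1 = 2 , dynamicMinBase , λ n W {s = R} reach {u} {M'} valid →
  let inv = reachable-invariant reach
      m   = update (suc ⌊log₂ n ⌋) R u
  in eval M' m , base (eval M' m) , cost M' m , realize-runs M' base m ,
     ≤-trans (update-cost M' _ R u) (2+⌊log₂n⌋≤2*[1+⌊log₂Wn⌋] n (valid⇒1≤W inv valid)) ,
     invariant-minBase (update-invariant inv valid)
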